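{- Let $G=(V,E)$ be a directed graph, $K\geq 2$ an integer, $\mathscr C$ its set of directed cycle covers and $\mathscr H\subseteq\mathscr C$ its set of directed Hamiltonian cycles. For every $C\in\mathscr C$, \[ [C\in\mathscr H] = h(C) \pmod K, \] where for an edge subset $T\subseteq E$, \[ h(T)=\frac{1}{K}\sum_{Y_1,\ldots,Y_K}\prod_{e\in T}[\,e\in G[Y_1]\cup\cdots\cup G[Y_K]\,], \] the sum ranging over all ordered $K$-partitions $(Y_1,\ldots,Y_K)$ of $V$ (pairwise disjoint, possibly empty parts with union $V$).
   Context: A directed cycle cover is a set of directed edges of $G$ forming vertex-disjoint directed cycles that together cover every vertex. A directed Hamiltonian cycle is a directed cycle visiting every vertex exactly once. $[P]$ is $1$ if the proposition $P$ holds and $0$ otherwise. $G[Y]$ is the subgraph induced by $Y\subseteq V$, and $e\in G[Y]$ means that the directed edge $e$ has both endpoints in $Y$. -}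

module Defs where

open import Data.Nat using (ℕ; zero; suc; _*_; _+_; NonZero; _/_)
open import Data.Fin using (Fin; zero; suc; inject₁; fromℕ; _≟_)
open import Data.Bool using (Bool; true; false; _∧_; if_then_else_)
open import Data.List using (List; map; concatMap; [_])
open import Data.Nat.ListAction using (sum; product)
open import Data.List using (allFin) renaming (lookup to lookupL)
open import Data.Vec.Functional using (_∷_)
open import Data.Product using (Σ; ∃; _×_; _,_)
open import Data.Sum using (_⊎_)
open import Function.Definitions using (Injective; Surjective)
open import Relation.Binary.PropositionalEquality using (_≡_)
open import Relation.Nullary.Decidable using (isYes)

⟦_⟧ : Bool → ℕ
⟦ true ⟧  = 1
⟦ false ⟧ = 0

-- A directed graph on the vertex set V = Fin n is given by its edge
-- relation E : Fin n → Fin n → Bool  ((u , v) ∈ E  iff  E u v ≡ true).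
-- An edge subset T ⊆ V × V is likewise a Bool-valued relation.
EdgeSet : ℕ → Set
EdgeSet n = Fin n → Fin n → Bool

_⊆ₑ_ : ∀ {n} → EdgeSet n → EdgeSet n → Set
T ⊆ₑ E = ∀ u v → T u v ≡ true → E u v ≡ true

-- A directed cycle in Fin n: a sequence of suc m pairwise distinct vertices
-- f 0, f 1, …, f m ; its edges are (f i , f (i+1)) and (f m , f 0).
record Cycle (n : ℕ) : Set where
  field
    len-1 : ℕ
    vert  : Fin (suc len-1) → Fin n
    distinct : Injective _≡_ _≡_ vert
open Cycle public

_∈V_ : ∀ {n} → Fin n → Cycle n → Set
v ∈V c = ∃ λ i → vert c i ≡ v

CycEdge : ∀ {n} → Cycle n → Fin n → Fin n → Set
CycEdge c u v =
  (∃ λ (i : Fin (len-1 c)) → (vert c (inject₁ i) ≡ u) × (vert c (suc i) ≡ v))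
  ⊎ ((vert c (fromℕ (len-1 c)) ≡ u) × (vert c zero ≡ v))

IsCycleCover : ∀ {n} → EdgeSet n → EdgeSet n → Set
IsCycleCover {n} E C =
  (C ⊆ₑ E) ×
  (Σ (List (Cycle n)) λ cs →
     (∀ v → ∃ λ j → v ∈V lookupL cs j) ×
     (∀ v j j' → v ∈V lookupL cs j → v ∈V lookupL cs j' → j ≡ j') ×
     (∀ u v → C u v ≡ true → ∃ λ j → CycEdge (lookupL cs j) u v) ×
     (∀ u v j → CycEdge (lookupL cs j) u v → C u v ≡ true))

IsHamiltonian : ∀ {n} → EdgeSet n → EdgeSet n → Set
IsHamiltonian {n} E C =
  (C ⊆ₑ E) ×
  (Σ (Cycle n) λ c →
     (∀ v → v ∈V c) ×
     (∀ u v → C u v ≡ true → CycEdge c u v) ×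
     (∀ u v → CycEdge c u v → C u v ≡ true))

-- All maps χ : Fin n → Fin K.  An ordered K-partition (Y₁,…,Y_K) of V
-- (pairwise disjoint, possibly empty, union V) is the same as such a map,
-- with Y_i = χ⁻¹(i).
allMaps : (n K : ℕ) → List (Fin n → Fin K)
allMaps zero    K = [ (λ ()) ]
allMaps (suc n) K = concatMap (λ c → map (λ f → c ∷ f) (allMaps n K)) (allFin K)

prodOver : ∀ {n} → EdgeSet n → (Fin n → Fin n → ℕ) → ℕ
prodOver {n} T g =
  product (concatMap (λ u → map (λ v → if T u v then g u v else 1) (allFin n)) (allFin n))

inUnion : ∀ {n K} → EdgeSet n → (Fin n → Fin K) → Fin n → Fin n → ℕ
inUnion E χ u v = ⟦ E u v ∧ isYes (χ u ≟ χ v) ⟧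

hSum : ∀ {n} (K : ℕ) → EdgeSet n → EdgeSet n → ℕ
hSum {n} K E T = sum (map (λ χ → prodOver T (inUnion E χ)) (allMaps n K))

h : ∀ {n} (K : ℕ) .{{_ : NonZero K}} → EdgeSet n → EdgeSet n → ℕ
h K E T = hSum K E T / K

module Submission where

-- A colouring χ : V → Fin K (the partition Yᵢ = χ⁻¹(i)) keeps every edge of a
-- cycle cover C inside one part iff χ is constant on each cycle of C.  So the
-- sum defining h(C) counts the colourings of the c cycles of C, giving K ^ c,
-- and h(C) = K ^ (c - 1): this is 1 when C is a single, i.e. Hamiltonian,
-- cycle and divisible by K when c ≥ 2.  (For c = 0, the empty graph,
-- h(C) = 1 / K truncates to 0.)

open import Defs
open import Algebra.Properties.CommutativeSemigroup using (interchange)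
open import Data.Bool using (Bool; true; false; if_then_else_)
open import Data.Fin using (Fin; zero; suc; inject₁; fromℕ; _≟_)
open import Data.Fin.Properties using (all?; suc-injective)
open import Data.List using (List; []; _∷_; map; concat; concatMap; allFin; length)
  renaming (lookup to lookupL)
open import Data.List.Properties using (map-cong; map-tabulate; map-concatMap; map-∘)
open import Data.List.Relation.Unary.All using (All; []; _∷_)
import Data.List.Relation.Unary.All.Properties as All
open import Data.Nat using (ℕ; zero; suc; _+_; _*_; _^_; _≤_; _%_; _/_; NonZero)
open import Data.Nat.DivMod using (m*n%n≡0; n/n≡1; m*n/n≡m; m<n⇒m/n≡0)
open import Data.Nat.ListAction using (sum; product)
open import Data.Nat.ListAction.Properties using (sum-++)
open import Data.Nat.Properties
  using (+-identityʳ; *-comm; *-identityʳ; m*n≡1⇒m≡1; m*n≡1⇒n≡1; +-commutativeSemigroup)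
open import Data.Product using (Σ; _×_; _,_; proj₁; proj₂)
open import Data.Sum using (_⊎_; inj₁; inj₂)
open import Data.Vec.Functional using () renaming (_∷_ to _∷ᵥ_)
open import Function using (id; _∘_; _$_)
open import Relation.Binary.PropositionalEquality
open import Relation.Nullary using (Dec; yes; no; ¬_; contradiction)
open import Relation.Nullary.Decidable using (isYes)

private
  variable
    A B : Set
    n K : ℕ

⟪_⟫ : ∀ {p} {P : Set p} → Dec P → ℕ
⟪ d ⟫ = ⟦ isYes d ⟧

Bit : ℕ → Set
Bit x = x ≡ 0 ⊎ x ≡ 1

⟦⟧-bit : ∀ b → Bit ⟦ b ⟧
⟦⟧-bit true  = inj₂ refl
⟦⟧-bit false = inj₁ refl

module _ {p} {P : Set p} where

  ⟪⟫-yes : (d : Dec P) → P → ⟪ d ⟫ ≡ 1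
  ⟪⟫-yes (yes _) _ = refl
  ⟪⟫-yes (no ¬p) p = contradiction p ¬p

  ⟪⟫-no : (d : Dec P) → ¬ P → ⟪ d ⟫ ≡ 0
  ⟪⟫-no (yes p) ¬p = contradiction p ¬p
  ⟪⟫-no (no _)  _  = refl

  bit≡⟪⟫ : ∀ {x} → Bit x → (x ≡ 1 → P) → (P → x ≡ 1) → (d : Dec P) → x ≡ ⟪ d ⟫
  bit≡⟪⟫ _           _     p⇒1 (yes p)  = p⇒1 p
  bit≡⟪⟫ (inj₁ refl) _     _   (no _)   = refl
  bit≡⟪⟫ (inj₂ refl) 1⇒p   _   (no ¬p)  = contradiction (1⇒p refl) ¬p

⟪⟫-cong : ∀ {p q} {P : Set p} {Q : Set q} (d : Dec P) (e : Dec Q) →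
          (P → Q) → (Q → P) → ⟪ d ⟫ ≡ ⟪ e ⟫
⟪⟫-cong (yes p) e P⇒Q _   = sym (⟪⟫-yes e (P⇒Q p))
⟪⟫-cong (no ¬p) e _   Q⇒P = sym (⟪⟫-no e (¬p ∘ Q⇒P))

sum-map-cong : {f g : A → ℕ} → f ≗ g → (xs : List A) → sum (map f xs) ≡ sum (map g xs)
sum-map-cong f≗g xs = cong sum (map-cong f≗g xs)

sum-map-zero : (xs : List A) → sum (map (λ _ → 0) xs) ≡ 0
sum-map-zero []       = refl
sum-map-zero (_ ∷ xs) = sum-map-zero xs

sum-map-+ : (f g : A → ℕ) (xs : List A) →
            sum (map (λ x → f x + g x) xs) ≡ sum (map f xs) + sum (map g xs)
sum-map-+ f g []       = refl
sum-map-+ f g (x ∷ xs) rewrite sum-map-+ f g xs =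
  interchange +-commutativeSemigroup (f x) (g x) (sum (map f xs)) (sum (map g xs))

sum-map-swap : (F : A → B → ℕ) (xs : List A) (ys : List B) →
               sum (map (λ x → sum (map (F x) ys)) xs) ≡ sum (map (λ y → sum (map (λ x → F x y) xs)) ys)
sum-map-swap F []       ys = sym (sum-map-zero ys)
sum-map-swap F (x ∷ xs) ys rewrite sum-map-swap F xs ys =
  sym (sum-map-+ (F x) (λ y → sum (map (λ x → F x y) xs)) ys)

sum-concat : (xss : List (List ℕ)) → sum (concat xss) ≡ sum (map sum xss)
sum-concat []         = refl
sum-concat (xs ∷ xss) = trans (sum-++ xs (concat xss)) (cong (sum xs +_) (sum-concat xss))

∑Fin : (K : ℕ) → (Fin K → ℕ) → ℕ
∑Fin K f = sum (map f (allFin K))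

∑Fin-cong : ∀ K {f g : Fin K → ℕ} → f ≗ g → ∑Fin K f ≡ ∑Fin K g
∑Fin-cong K f≗g = sum-map-cong f≗g (allFin K)

∑Fin-suc : ∀ K (f : Fin (suc K) → ℕ) → ∑Fin (suc K) f ≡ f zero + ∑Fin K (f ∘ suc)
∑Fin-suc K f = trans (cong sum (map-tabulate id f))
                     (cong (λ l → f zero + sum l) (sym (map-tabulate id (f ∘ suc))))

∑Fin-const : ∀ K a → ∑Fin K (λ _ → a) ≡ K * a
∑Fin-const zero    a = refl
∑Fin-const (suc K) a = trans (∑Fin-suc K _) (cong (a +_) (∑Fin-const K a))

∑Fin-δ : ∀ K (d : Fin K) → ∑Fin K (λ c → ⟪ c ≟ d ⟫) ≡ 1
∑Fin-δ (suc K) zero = begin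
  ∑Fin (suc K) (λ c → ⟪ c ≟ zero ⟫)        ≡⟨ ∑Fin-suc K (λ c → ⟪ c ≟ zero ⟫) ⟩
  1 + ∑Fin K (λ c → ⟪ suc c ≟ zero ⟫)      ≡⟨ cong suc (∑Fin-cong K (λ c → ⟪⟫-no (suc c ≟ zero) λ ())) ⟩
  1 + ∑Fin K (λ _ → 0)                     ≡⟨ cong suc (trans (∑Fin-const K 0) (*-comm K 0)) ⟩
  1                                        ∎
  where open ≡-Reasoning
∑Fin-δ (suc K) (suc d) = begin
  ∑Fin (suc K) (λ c → ⟪ c ≟ suc d ⟫)       ≡⟨ ∑Fin-suc K (λ c → ⟪ c ≟ suc d ⟫) ⟩
  0 + ∑Fin K (λ c → ⟪ suc c ≟ suc d ⟫)     ≡⟨ ∑Fin-cong K (λ c → ⟪⟫-cong (suc c ≟ suc d) (c ≟ d) suc-injective (cong suc)) ⟩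
  ∑Fin K (λ c → ⟪ c ≟ d ⟫)                 ≡⟨ ∑Fin-δ K d ⟩
  1                                        ∎
  where open ≡-Reasoning

∑Map : (n K : ℕ) → ((Fin n → Fin K) → ℕ) → ℕ
∑Map n K F = sum (map F (allMaps n K))

∑Map-cong : ∀ n K {F G : (Fin n → Fin K) → ℕ} → F ≗ G → ∑Map n K F ≡ ∑Map n K G
∑Map-cong n K F≗G = sum-map-cong F≗G (allMaps n K)

∑Map-zero : ∀ n K → ∑Map n K (λ _ → 0) ≡ 0
∑Map-zero n K = sum-map-zero (allMaps n K)

∑Map-swap : ∀ m n K (F : (Fin m → Fin K) → (Fin n → Fin K) → ℕ) →
            ∑Map m K (λ χ → ∑Map n K (F χ)) ≡ ∑Map n K (λ ψ → ∑Map m K (λ χ → F χ ψ))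
∑Map-swap m n K F = sum-map-swap F (allMaps m K) (allMaps n K)

∑Map-suc : ∀ n K F → ∑Map (suc n) K F ≡ ∑Fin K (λ c → ∑Map n K (F ∘ (c ∷ᵥ_)))
∑Map-suc n K F = begin
  sum (map F (concatMap extend (allFin K)))            ≡⟨ cong sum (map-concatMap F extend (allFin K)) ⟩
  sum (concat (map (map F ∘ extend) (allFin K)))       ≡⟨ sum-concat (map (map F ∘ extend) (allFin K)) ⟩
  sum (map sum (map (map F ∘ extend) (allFin K)))      ≡⟨ cong sum (sym (map-∘ (allFin K))) ⟩
  ∑Fin K (λ c → sum (map F (extend c)))                ≡⟨ ∑Fin-cong K (λ c → cong sum (sym (map-∘ (allMaps n K)))) ⟩
  ∑Fin K (λ c → ∑Map n K (F ∘ (c ∷ᵥ_)))                ∎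
  where
  open ≡-Reasoning
  extend : Fin K → List (Fin (suc n) → Fin K)
  extend c = map (c ∷ᵥ_) (allMaps n K)

∑Map-one : ∀ n K → ∑Map n K (λ _ → 1) ≡ K ^ n
∑Map-one zero    K = refl
∑Map-one (suc n) K = begin
  ∑Map (suc n) K (λ _ → 1)        ≡⟨ ∑Map-suc n K _ ⟩
  ∑Fin K (λ _ → ∑Map n K (λ _ → 1)) ≡⟨ ∑Fin-cong K (λ _ → ∑Map-one n K) ⟩
  ∑Fin K (λ _ → K ^ n)            ≡⟨ ∑Fin-const K (K ^ n) ⟩
  K ^ suc n                       ∎
  where open ≡-Reasoning

_≗?_ : (f g : Fin n → Fin K) → Dec (f ≗ g)
f ≗? g = all? (λ i → f i ≟ g i)

∑Map-δ : ∀ n K (g : Fin n → Fin K) → ∑Map n K (λ χ → ⟪ χ ≗? g ⟫) ≡ 1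
∑Map-δ zero    K g = refl
∑Map-δ (suc n) K g = begin
  ∑Map (suc n) K (λ χ → ⟪ χ ≗? g ⟫)                  ≡⟨ ∑Map-suc n K _ ⟩
  ∑Fin K (λ c → ∑Map n K (λ χ → ⟪ (c ∷ᵥ χ) ≗? g ⟫))  ≡⟨ ∑Fin-cong K tail-sum ⟩
  ∑Fin K (λ c → ⟪ c ≟ g zero ⟫)                      ≡⟨ ∑Fin-δ K (g zero) ⟩
  1                                                  ∎
  where
  open ≡-Reasoning
  tail-sum : ∀ c → ∑Map n K (λ χ → ⟪ (c ∷ᵥ χ) ≗? g ⟫) ≡ ⟪ c ≟ g zero ⟫
  tail-sum c = by-cases (c ≟ g zero)
    where
    by-cases : (d : Dec (c ≡ g zero)) → ∑Map n K (λ χ → ⟪ (c ∷ᵥ χ) ≗? g ⟫) ≡ ⟪ d ⟫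
    by-cases (yes c≡g₀) = trans (∑Map-cong n K λ χ → ⟪⟫-cong ((c ∷ᵥ χ) ≗? g) (χ ≗? (g ∘ suc))
                                                      (λ e → e ∘ suc) λ { e zero → c≡g₀ ; e (suc i) → e i })
                                (∑Map-δ n K (g ∘ suc))
    by-cases (no c≢g₀)  = trans (∑Map-cong n K λ χ → ⟪⟫-no ((c ∷ᵥ χ) ≗? g) (c≢g₀ ∘ (_$ zero)))
                                (∑Map-zero n K)

-- χ factors through a surjection `idx` with section `rep` iff χ = χ ∘ rep ∘ idx;
-- the factor is then unique, so these χ correspond to the maps Fin c → Fin K.
∑Map-factorsThrough≡^ : ∀ n c K (idx : Fin n → Fin c) (rep : Fin c → Fin n) →
                        (∀ j → idx (rep j) ≡ j) →
                        ∑Map n K (λ χ → ⟪ χ ≗? (χ ∘ rep ∘ idx) ⟫) ≡ K ^ c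
∑Map-factorsThrough≡^ n c K idx rep idx∘rep = begin
  ∑Map n K (λ χ → ⟪ χ ≗? (χ ∘ rep ∘ idx) ⟫)              ≡⟨ ∑Map-cong n K lifts ⟩
  ∑Map n K (λ χ → ∑Map c K (λ ψ → ⟪ χ ≗? (ψ ∘ idx) ⟫))   ≡⟨ ∑Map-swap n c K _ ⟩
  ∑Map c K (λ ψ → ∑Map n K (λ χ → ⟪ χ ≗? (ψ ∘ idx) ⟫))   ≡⟨ ∑Map-cong c K (λ ψ → ∑Map-δ n K (ψ ∘ idx)) ⟩
  ∑Map c K (λ _ → 1)                                      ≡⟨ ∑Map-one c K ⟩
  K ^ c                                                   ∎
  where
  open ≡-Reasoning
  lifts : ∀ χ → ⟪ χ ≗? (χ ∘ rep ∘ idx) ⟫ ≡ ∑Map c K (λ ψ → ⟪ χ ≗? (ψ ∘ idx) ⟫)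
  lifts χ with χ ≗? (χ ∘ rep ∘ idx)
  ... | yes factors = sym (trans
          (∑Map-cong c K λ ψ → ⟪⟫-cong (χ ≗? (ψ ∘ idx)) (ψ ≗? (χ ∘ rep))
             (λ e j → trans (cong ψ (sym (idx∘rep j))) (sym (e (rep j))))
             (λ e v → trans (factors v) (sym (e (idx v)))))
          (∑Map-δ c K (χ ∘ rep)))
  ... | no ¬factors = sym (trans
          (∑Map-cong c K λ ψ → ⟪⟫-no (χ ≗? (ψ ∘ idx)) λ e →
             ¬factors λ v → trans (e v) (trans (cong ψ (sym (idx∘rep (idx v)))) (sym (e (rep (idx v))))))
          (∑Map-zero c K))

All≡1⇒product≡1 : ∀ {xs} → All (_≡ 1) xs → product xs ≡ 1
All≡1⇒product≡1 []         = refl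
All≡1⇒product≡1 (refl ∷ a) = trans (+-identityʳ _) (All≡1⇒product≡1 a)

product≡1⇒All≡1 : ∀ xs → product xs ≡ 1 → All (_≡ 1) xs
product≡1⇒All≡1 []       _ = []
product≡1⇒All≡1 (x ∷ xs) e = m*n≡1⇒m≡1 x _ e ∷ product≡1⇒All≡1 xs (m*n≡1⇒n≡1 x _ e)

product-bit : ∀ {xs} → All Bit xs → Bit (product xs)
product-bit []                = inj₂ refl
product-bit (inj₁ refl ∷ _)   = inj₁ refl
product-bit (inj₂ refl ∷ bs) with product-bit bs
... | inj₁ e = inj₁ (trans (+-identityʳ _) e)
... | inj₂ e = inj₂ (trans (+-identityʳ _) e)

if-true : ∀ {b : Bool} {x y : ℕ} → b ≡ true → (if b then x else y) ≡ x
if-true refl = refl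

module _ (T : EdgeSet n) (g : Fin n → Fin n → ℕ) where
  private
    entry : Fin n → Fin n → ℕ
    entry u v = if T u v then g u v else 1

    entries : List ℕ
    entries = concatMap (λ u → map (entry u) (allFin n)) (allFin n)

    all-entries⁺ : ∀ {P : ℕ → Set} → (∀ u v → P (entry u v)) → All P entries
    all-entries⁺ P = All.concat⁺ (All.map⁺ (All.tabulate⁺ λ u → All.map⁺ (All.tabulate⁺ (P u))))

    all-entries⁻ : ∀ {P : ℕ → Set} → All P entries → ∀ u v → P (entry u v)
    all-entries⁻ a u = All.tabulate⁻ (All.map⁻ (All.tabulate⁻ (All.map⁻ (All.concat⁻ a)) u))

  prodOver-bit : (∀ u v → Bit (g u v)) → Bit (prodOver T g)
  prodOver-bit bits = product-bit (all-entries⁺ λ u v → entry-bit (T u v) (bits u v))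
    where
    entry-bit : ∀ b {x} → Bit x → Bit (if b then x else 1)
    entry-bit true  bit = bit
    entry-bit false _   = inj₂ refl

  prodOver≡1⇒ : prodOver T g ≡ 1 → ∀ u v → T u v ≡ true → g u v ≡ 1
  prodOver≡1⇒ e u v t = trans (sym (if-true t)) (all-entries⁻ (product≡1⇒All≡1 entries e) u v)

  prodOver≡1⇐ : (∀ u v → T u v ≡ true → g u v ≡ 1) → prodOver T g ≡ 1
  prodOver≡1⇐ ones = All≡1⇒product≡1 (all-entries⁺ λ u v → entry≡1 (T u v) (ones u v))
    where
    entry≡1 : ∀ b {x} → (b ≡ true → x ≡ 1) → (if b then x else 1) ≡ 1
    entry≡1 true  x≡1 = x≡1 refl
    entry≡1 false _   = refl

inUnion≡1⇒ : (E : EdgeSet n) (χ : Fin n → Fin K) → ∀ u v → inUnion E χ u v ≡ 1 → χ u ≡ χ v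
inUnion≡1⇒ E χ u v with E u v | χ u ≟ χ v
... | true  | yes p = λ _ → p
... | true  | no _  = λ ()
... | false | _     = λ ()

inUnion≡1⇐ : (E : EdgeSet n) (χ : Fin n → Fin K) → ∀ u v → E u v ≡ true → χ u ≡ χ v → inUnion E χ u v ≡ 1
inUnion≡1⇐ E χ u v e p rewrite e = ⟪⟫-yes (χ u ≟ χ v) p

Monochromatic : EdgeSet n → (Fin n → A) → Set
Monochromatic T χ = ∀ u v → T u v ≡ true → χ u ≡ χ v

prodOver-inUnion≡⟪⟫ : ∀ {q} {Q : Set q} (E T : EdgeSet n) (χ : Fin n → Fin K) → T ⊆ₑ E →
                      (Q? : Dec Q) → (Monochromatic T χ → Q) → (Q → Monochromatic T χ) →
                      prodOver T (inUnion E χ) ≡ ⟪ Q? ⟫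
prodOver-inUnion≡⟪⟫ E T χ T⊆E Q? mono⇒Q Q⇒mono =
  bit≡⟪⟫ (prodOver-bit T _ (λ u v → ⟦⟧-bit _))
         (λ e → mono⇒Q λ u v t → inUnion≡1⇒ E χ u v (prodOver≡1⇒ T _ e u v t))
         (λ q → prodOver≡1⇐ T _ λ u v t → inUnion≡1⇐ E χ u v (T⊆E u v t) (Q⇒mono q u v t))
         Q?

constant-along : ∀ {L} (g : Fin (suc L) → A) → (∀ i → g (inject₁ i) ≡ g (suc i)) → ∀ i → g i ≡ g zero
constant-along {L = zero}  g _    zero    = refl
constant-along {L = suc L} g _    zero    = refl
constant-along {L = suc L} g step (suc i) =
  trans (sym (step i)) (constant-along (g ∘ inject₁) (step ∘ inject₁) i)

cycle-constant : (f : Fin n → A) (cy : Cycle n) → (∀ u v → CycEdge cy u v → f u ≡ f v) →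
                 ∀ i → f (vert cy i) ≡ f (vert cy zero)
cycle-constant f cy edge = constant-along (f ∘ vert cy) (λ i → edge _ _ (inj₁ (i , refl , refl)))

cycEdge-endpoints : (cy : Cycle n) → ∀ {u v} → CycEdge cy u v → u ∈V cy × v ∈V cy
cycEdge-endpoints cy (inj₁ (i , p , q)) = (inject₁ i , p) , (suc i , q)
cycEdge-endpoints cy (inj₂ (p , q))     = (fromℕ (len-1 cy) , p) , (zero , q)

Contractible : Set → Set
Contractible A = Σ A λ x → ∀ y → y ≡ x

Fin-contractible⇒≡1 : ∀ {m} → Contractible (Fin m) → m ≡ 1
Fin-contractible⇒≡1 {suc zero}    _          = refl
Fin-contractible⇒≡1 {suc (suc m)} (_ , all≡) with () ← trans (all≡ zero) (sym (all≡ (suc zero)))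

≡1⇒Fin-contractible : ∀ {m} → m ≡ 1 → Contractible (Fin m)
≡1⇒Fin-contractible refl = zero , λ { zero → refl }

module CycleCover {E C : EdgeSet n} (cover : IsCycleCover E C) where

  C⊆E : C ⊆ₑ E
  C⊆E = proj₁ cover

  cycles : List (Cycle n)
  cycles = proj₁ (proj₂ cover)

  #cycles : ℕ
  #cycles = length cycles

  private
    covered : ∀ v → Σ (Fin #cycles) λ j → v ∈V lookupL cycles j
    covered = proj₁ (proj₂ (proj₂ cover))

    disjoint : ∀ v j j' → v ∈V lookupL cycles j → v ∈V lookupL cycles j' → j ≡ j'
    disjoint = proj₁ (proj₂ (proj₂ (proj₂ cover)))

    C⇒cycEdge : ∀ u v → C u v ≡ true → Σ (Fin #cycles) λ j → CycEdge (lookupL cycles j) u v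
    C⇒cycEdge = proj₁ (proj₂ (proj₂ (proj₂ (proj₂ cover))))

    cycEdge⇒C : ∀ u v j → CycEdge (lookupL cycles j) u v → C u v ≡ true
    cycEdge⇒C = proj₂ (proj₂ (proj₂ (proj₂ (proj₂ cover))))

  cycleOf : Fin n → Fin #cycles
  cycleOf v = proj₁ (covered v)

  root : Fin #cycles → Fin n
  root j = vert (lookupL cycles j) zero

  cycleOf-root : ∀ j → cycleOf (root j) ≡ j
  cycleOf-root j = disjoint (root j) _ j (proj₂ (covered (root j))) (zero , refl)

  cycleOf-monochromatic : Monochromatic C cycleOf
  cycleOf-monochromatic u v e with C⇒cycEdge u v e
  ... | j , uv = let (u∈ , v∈) = cycEdge-endpoints (lookupL cycles j) uv in
                 trans (disjoint u _ j (proj₂ (covered u)) u∈) (sym (disjoint v _ j (proj₂ (covered v)) v∈))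

  monochromatic⇒factors : (χ : Fin n → A) → Monochromatic C χ → χ ≗ χ ∘ root ∘ cycleOf
  monochromatic⇒factors χ mono v with covered v
  ... | j , i , vert≡v = trans (cong χ (sym vert≡v))
                               (cycle-constant χ (lookupL cycles j) (λ u w uw → mono u w (cycEdge⇒C u w j uw)) i)

  factors⇒monochromatic : (χ : Fin n → A) → χ ≗ χ ∘ root ∘ cycleOf → Monochromatic C χ
  factors⇒monochromatic χ factors u v e =
    trans (factors u) (trans (cong (χ ∘ root) (cycleOf-monochromatic u v e)) (sym (factors v)))

  hSum≡K^#cycles : ∀ K → hSum K E C ≡ K ^ #cycles
  hSum≡K^#cycles K = trans
    (∑Map-cong n K λ χ → prodOver-inUnion≡⟪⟫ E C χ C⊆E (χ ≗? (χ ∘ root ∘ cycleOf))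
                            (monochromatic⇒factors χ) (factors⇒monochromatic χ))
    (∑Map-factorsThrough≡^ n #cycles K cycleOf root cycleOf-root)

  hamiltonian⇒one-cycle : IsHamiltonian E C → Contractible (Fin #cycles)
  hamiltonian⇒one-cycle (_ , cy , spanning , _ , cycEdge⇒Cᴴ) = cycleOf (vert cy zero) , same-cycle
    where
    same-cycle : ∀ j → j ≡ cycleOf (vert cy zero)
    same-cycle j with spanning (root j)
    ... | i , vert≡root = trans (sym (cycleOf-root j)) (trans (cong cycleOf (sym vert≡root))
                            (cycle-constant cycleOf cy (λ u v uv → cycleOf-monochromatic u v (cycEdge⇒Cᴴ u v uv)) i))

  one-cycle⇒hamiltonian : Contractible (Fin #cycles) → IsHamiltonian E C
  one-cycle⇒hamiltonian (j , all≡j) =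
    C⊆E , lookupL cycles j ,
    (λ v → subst (λ j → v ∈V lookupL cycles j) (all≡j (cycleOf v)) (proj₂ (covered v))) ,
    (λ u v e → let (j' , uv) = C⇒cycEdge u v e in subst (λ j → CycEdge (lookupL cycles j) u v) (all≡j j') uv) ,
    (λ u v → cycEdge⇒C u v j)

n^1/n≡1 : ∀ n .{{_ : NonZero n}} → n ^ 1 / n ≡ 1
n^1/n≡1 n = trans (cong (_/ n) (*-identityʳ n)) (n/n≡1 n)

n^m/n%n≡0 : ∀ n m .{{_ : NonZero n}} → 2 ≤ n → m ≢ 1 → n ^ m / n % n ≡ 0
n^m/n%n≡0 n zero          2≤n _   = trans (cong (_% n) (m<n⇒m/n≡0 2≤n)) (m*n%n≡0 0 n)
n^m/n%n≡0 n (suc zero)    _   m≢1 = contradiction refl m≢1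
n^m/n%n≡0 n (suc (suc k)) _   _   = begin
  n * n ^ suc k / n % n   ≡⟨ cong (λ x → x / n % n) (*-comm n (n ^ suc k)) ⟩
  n ^ suc k * n / n % n   ≡⟨ cong (_% n) (m*n/n≡m (n ^ suc k) n) ⟩
  n * n ^ k % n           ≡⟨ cong (_% n) (*-comm n (n ^ k)) ⟩
  n ^ k * n % n           ≡⟨ m*n%n≡0 (n ^ k) n ⟩
  0                       ∎
  where open ≡-Reasoning

lemma7 : (n : ℕ) (E : EdgeSet n) (K : ℕ) .{{_ : NonZero K}} → 2 ≤ K →
         (C : EdgeSet n) → IsCycleCover E C →
         (IsHamiltonian E C → 1 % K ≡ h K E C % K) ×
         (¬ IsHamiltonian E C → 0 % K ≡ h K E C % K)
lemma7 n E K 2≤K C cover = hamiltonian , non-hamiltonian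
  where
  open CycleCover cover

  h≡ : h K E C ≡ K ^ #cycles / K
  h≡ = cong (_/ K) (hSum≡K^#cycles K)

  hamiltonian : IsHamiltonian E C → 1 % K ≡ h K E C % K
  hamiltonian H = cong (_% K) (sym (begin
    h K E C         ≡⟨ h≡ ⟩
    K ^ #cycles / K ≡⟨ cong (λ c → K ^ c / K) (Fin-contractible⇒≡1 (hamiltonian⇒one-cycle H)) ⟩
    K ^ 1 / K       ≡⟨ n^1/n≡1 K ⟩
    1               ∎))
    where open ≡-Reasoning

  non-hamiltonian : ¬ IsHamiltonian E C → 0 % K ≡ h K E C % K
  non-hamiltonian ¬H = begin
    0 % K               ≡⟨ m*n%n≡0 0 K ⟩
    0                   ≡⟨ n^m/n%n≡0 K #cycles 2≤K (¬H ∘ one-cycle⇒hamiltonian ∘ ≡1⇒Fin-contractible) ⟨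
    K ^ #cycles / K % K ≡⟨ cong (_% K) h≡ ⟨
    h K E C % K         ∎
    where open ≡-Reasoning
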